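{- Let $(T,\eta,\mu)$ be a monad on a category $\mathcal{C}$ with Eilenberg-Moore adjunction $\mathcal{F}\dashv U$. Let $A$ be an endofunctor on $\mathcal{C}$ with initial algebra $\beta\colon A(\Psi)\xrightarrow{\cong}\Psi$, $\lambda\colon AT\Rightarrow TA$ a Kleisli law such that $(\Psi,J(\beta^{ -1}))$ is a final coalgebra of the extension $\overline{A}$ of $A$ to $\mathcal{K}\ell(T)$, $B$ an endofunctor on $\mathcal{C}$ with final coalgebra $\zeta\colon\Theta\xrightarrow{\cong}B(\Theta)$, $\kappa\colon TB\Rightarrow BT$ an Eilenberg-Moore law with lifting $\overline{B}$, and $\rho\colon AU\Rightarrow U\overline{B}$ a natural transformation. Assume that for every Eilenberg-Moore algebra $(Y,b)$, $\rho_{(Y,b)}\circ A(b)=B(b)\circ\kappa_Y\circ T(\rho_{(Y,b)})\circ\lambda_Y$. Let $a\colon T(\Theta)\to\Theta$ be the unique map with $\zeta\circ a=B(a)\circ\kappa_\Theta\circ T(\zeta)$, let $\mathsf{k}\colon\Psi\to\Theta$ be the unique map with $\mathsf{k}\circ\beta=\zeta^{ -1}\circ\rho_{(\Theta,a)}\circ A(\mathsf{k})$, and $\overline{\mathsf{k}}=a\circ T(\mathsf{k})\colon T(\Psi)\to\Theta$. Let $\ell_{\mathrm{kl}}=T(\beta)\circ\mu_{A(\Psi)}\circ T(\lambda_\Psi)$ and $\ell^A_{\mathrm{em}}=\zeta^{ -1}\circ B(a)\circ(\rho_2)_\Theta\colon TA(\Theta)\to\Theta$. Then $\overline{\mathsf{k}}\circ\ell_{\mathrm{kl}}=\ell^A_{\mathrm{em}}\circ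 TA(\overline{\mathsf{k}})$. Consequently, for every coalgebra $c\colon X\to TA(X)$, $\overline{\mathsf{k}}\circ\mathsf{kl}_c=\mathsf{em}^A_c$, where $\mathsf{kl}_c\colon X\to T(\Psi)$ is the unique map with $\mathsf{kl}_c=\ell_{\mathrm{kl}}\circ TA(\mathsf{kl}_c)\circ c$ and $\mathsf{em}^A_c\colon X\to\Theta$ is the unique map with $\mathsf{em}^A_c=\ell^A_{\mathrm{em}}\circ TA(\mathsf{em}^A_c)\circ c$.
   Context: A Kleisli law satisfies $\lambda\circ A\eta=\eta A$, $\lambda\circ A\mu=\mu A\circ T\lambda\circ\lambda T$; its extension $\overline{A}$ sends a Kleisli map $f\colon X\to T(Y)$ to $\lambda_Y\circ A(f)$, and $J(f)=\eta\circ f$. An Eilenberg-Moore law satisfies $\kappa\circ\eta B=B\eta$, $\kappa\circ\mu B=B\mu\circ\kappa T\circ T\kappa$; its lifting is $\overline{B}(Y,b)=(B(Y),B(b)\circ\kappa_Y)$; $(\Theta,a)$ is an Eilenberg-Moore algebra. $(\rho_2)_X=B(\mu_X)\circ\kappa_{T(X)}\circ T(\rho_{(T(X),\mu_X)})\circ TA(\eta_X)$. The maps $\mathsf{k}$, $\mathsf{kl}_c$, $\mathsf{em}^A_c$ described exist and are unique. -}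

module Defs where

open import Level using (Level; _⊔_) renaming (suc to lsuc)
open import Relation.Binary using (Rel; IsEquivalence)
open import Data.Product using (Σ; _×_; _,_)

record Category (o ℓ e : Level) : Set (lsuc (o ⊔ ℓ ⊔ e)) where
  infixr 9 _∘_
  infix 4 _≈_
  field
    Obj : Set o
    Hom : Obj → Obj → Set ℓ
    _≈_ : ∀ {X Y} → Rel (Hom X Y) e
    id  : ∀ {X} → Hom X X
    _∘_ : ∀ {X Y Z} → Hom Y Z → Hom X Y → Hom X Z
    ≈-equiv : ∀ {X Y} → IsEquivalence (_≈_ {X} {Y})
    ∘-resp-≈ : ∀ {X Y Z} {f f' : Hom Y Z} {g g' : Hom X Y} →
               f ≈ f' → g ≈ g' → f ∘ g ≈ f' ∘ g'
    assoc : ∀ {W X Y Z} {f : Hom W X} {g : Hom X Y} {h : Hom Y Z} →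
            (h ∘ g) ∘ f ≈ h ∘ (g ∘ f)
    identityˡ : ∀ {X Y} {f : Hom X Y} → id ∘ f ≈ f
    identityʳ : ∀ {X Y} {f : Hom X Y} → f ∘ id ≈ f

module _ {o ℓ e : Level} (C : Category o ℓ e) where
  open Category C

  record Endofunctor : Set (o ⊔ ℓ ⊔ e) where
    field
      F₀ : Obj → Obj
      F₁ : ∀ {X Y} → Hom X Y → Hom (F₀ X) (F₀ Y)
      identity : ∀ {X} → F₁ (id {X}) ≈ id
      homomorphism : ∀ {X Y Z} {f : Hom X Y} {g : Hom Y Z} → F₁ (g ∘ f) ≈ F₁ g ∘ F₁ f
      F-resp-≈ : ∀ {X Y} {f g : Hom X Y} → f ≈ g → F₁ f ≈ F₁ g

  record Monad : Set (o ⊔ ℓ ⊔ e) where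
    field
      T : Endofunctor
    open Endofunctor T renaming (F₀ to T₀; F₁ to T₁)
    field
      η : ∀ X → Hom X (T₀ X)
      μ : ∀ X → Hom (T₀ (T₀ X)) (T₀ X)
      η-natural : ∀ {X Y} (f : Hom X Y) → η Y ∘ f ≈ T₁ f ∘ η X
      μ-natural : ∀ {X Y} (f : Hom X Y) → μ Y ∘ T₁ (T₁ f) ≈ T₁ f ∘ μ X
      μ∘Tη : ∀ X → μ X ∘ T₁ (η X) ≈ id
      μ∘ηT : ∀ X → μ X ∘ η (T₀ X) ≈ id
      μ-assoc : ∀ X → μ X ∘ T₁ (μ X) ≈ μ X ∘ μ (T₀ X)

  IsInverse : ∀ {X Y} → Hom X Y → Hom Y X → Set e
  IsInverse f g = (f ∘ g ≈ id) × (g ∘ f ≈ id)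

  IsInitialAlgebra : (F : Endofunctor) → (Z : Obj) → Hom (Endofunctor.F₀ F Z) Z → Set (o ⊔ ℓ ⊔ e)
  IsInitialAlgebra F Z z =
    ∀ (X : Obj) (x : Hom (F₀ X) X) →
      Σ (Hom Z X) λ h → (h ∘ z ≈ x ∘ F₁ h) × (∀ h' → h' ∘ z ≈ x ∘ F₁ h' → h' ≈ h)
    where open Endofunctor F

  IsFinalCoalgebra : (F : Endofunctor) → (Z : Obj) → Hom Z (Endofunctor.F₀ F Z) → Set (o ⊔ ℓ ⊔ e)
  IsFinalCoalgebra F Z z =
    ∀ (X : Obj) (c : Hom X (F₀ X)) →
      Σ (Hom X Z) λ h → (z ∘ h ≈ F₁ h ∘ c) × (∀ h' → z ∘ h' ≈ F₁ h' ∘ c → h' ≈ h)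
    where open Endofunctor F

  module _ (M : Monad) where
    open Monad M
    open Endofunctor T renaming (F₀ to T₀; F₁ to T₁)

    IsEMAlgebra : ∀ {Y} → Hom (T₀ Y) Y → Set e
    IsEMAlgebra {Y} b = (b ∘ η Y ≈ id) × (b ∘ T₁ b ≈ b ∘ μ Y)

    record EMAlgebra : Set (o ⊔ ℓ ⊔ e) where
      constructor emalg
      field
        carrier : Obj
        str : Hom (T₀ carrier) carrier
        isEM : IsEMAlgebra str

    open EMAlgebra

    IsEMAlgHom : (X Y : EMAlgebra) → Hom (carrier X) (carrier Y) → Set e
    IsEMAlgHom X Y h = h ∘ str X ≈ str Y ∘ T₁ h

    freeAlg : Obj → EMAlgebra
    freeAlg X = emalg (T₀ X) (μ X) (μ∘ηT X , μ-assoc X)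

    infixr 9 _⋆_
    _⋆_ : ∀ {X Y Z} → Hom Y (T₀ Z) → Hom X (T₀ Y) → Hom X (T₀ Z)
    _⋆_ {Z = Z} g f = μ Z ∘ (T₁ g ∘ f)

    J : ∀ {X Y} → Hom X Y → Hom X (T₀ Y)
    J {Y = Y} f = η Y ∘ f

    module _ (A : Endofunctor) where
      open Endofunctor A renaming (F₀ to A₀; F₁ to A₁)

      record IsKleisliLaw (λ' : ∀ X → Hom (A₀ (T₀ X)) (T₀ (A₀ X))) : Set (o ⊔ ℓ ⊔ e) where
        field
          natural : ∀ {X Y} (f : Hom X Y) → λ' Y ∘ A₁ (T₁ f) ≈ T₁ (A₁ f) ∘ λ' X
          law-η : ∀ X → λ' X ∘ A₁ (η X) ≈ η (A₀ X)
          law-μ : ∀ X → λ' X ∘ A₁ (μ X) ≈ μ (A₀ X) ∘ (T₁ (λ' X) ∘ λ' (T₀ X))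

      Ā₁ : (λ' : ∀ X → Hom (A₀ (T₀ X)) (T₀ (A₀ X))) →
           ∀ {X Y} → Hom X (T₀ Y) → Hom (A₀ X) (T₀ (A₀ Y))
      Ā₁ λ' {Y = Y} f = λ' Y ∘ A₁ f

      IsFinalĀCoalgebra : (λ' : ∀ X → Hom (A₀ (T₀ X)) (T₀ (A₀ X))) →
                          (Z : Obj) → Hom Z (T₀ (A₀ Z)) → Set (o ⊔ ℓ ⊔ e)
      IsFinalĀCoalgebra λ' Z z =
        ∀ (X : Obj) (c : Hom X (T₀ (A₀ X))) →
          Σ (Hom X (T₀ Z)) λ h → (z ⋆ h ≈ Ā₁ λ' h ⋆ c)
                               × (∀ h' → z ⋆ h' ≈ Ā₁ λ' h' ⋆ c → h' ≈ h)

    module _ (B : Endofunctor) where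
      open Endofunctor B renaming (F₀ to B₀; F₁ to B₁)

      record IsEMLaw (κ : ∀ X → Hom (T₀ (B₀ X)) (B₀ (T₀ X))) : Set (o ⊔ ℓ ⊔ e) where
        field
          natural : ∀ {X Y} (f : Hom X Y) → κ Y ∘ T₁ (B₁ f) ≈ B₁ (T₁ f) ∘ κ X
          law-η : ∀ X → κ X ∘ η (B₀ X) ≈ B₁ (η X)
          law-μ : ∀ X → κ X ∘ μ (B₀ X) ≈ B₁ (μ X) ∘ (κ (T₀ X) ∘ T₁ (κ X))

    module _ (A B : Endofunctor) where
      open Endofunctor A renaming (F₀ to A₀; F₁ to A₁)
      open Endofunctor B renaming (F₀ to B₀; F₁ to B₁)

      -- natural transformation ρ : AU ⇒ U B̄  (U B̄ (Y,b) = B(Y), U B̄ (h) = B(h))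
      IsNatAU⇒UB̄ : (ρ : (Y : EMAlgebra) → Hom (A₀ (carrier Y)) (B₀ (carrier Y))) → Set (o ⊔ ℓ ⊔ e)
      IsNatAU⇒UB̄ ρ = ∀ (X Y : EMAlgebra) (h : Hom (carrier X) (carrier Y)) →
                      IsEMAlgHom X Y h → ρ Y ∘ A₁ h ≈ B₁ h ∘ ρ X

      ρ₂ : (κ : ∀ X → Hom (T₀ (B₀ X)) (B₀ (T₀ X))) →
           (ρ : (Y : EMAlgebra) → Hom (A₀ (carrier Y)) (B₀ (carrier Y))) →
           ∀ X → Hom (T₀ (A₀ X)) (B₀ (T₀ X))
      ρ₂ κ ρ X = B₁ (μ X) ∘ (κ (T₀ X) ∘ (T₁ (ρ (freeAlg X)) ∘ T₁ (A₁ (η X))))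

module _ {o ℓ e : Level} {C : Category o ℓ e} where
  open Category C

  Fo : Endofunctor C → Obj → Obj
  Fo F = Endofunctor.F₀ F

  Fm : (F : Endofunctor C) → ∀ {X Y} → Hom X Y → Hom (Fo F X) (Fo F Y)
  Fm F = Endofunctor.F₁ F

-- Since (Θ, a) is an
-- Eilenberg-Moore algebra, k̄ = a ∘ T(k) is an algebra morphism out of the free
-- algebra, so it absorbs the multiplication in ℓkl; the defining equation of k
-- turns k ∘ β into ζ⁻¹ ∘ ρ ∘ A(k), the compatibility of ρ with λ and κ moves
-- the algebra structure through ρ, and at the algebra (Θ, a) the map ρ₂
-- collapses to κ ∘ T(ρ). The square says that k̄ carries solutions of the
-- ℓkl-recursion along any coalgebra c to solutions of the ℓem-recursion, and
-- uniqueness of the latter gives k̄ ∘ kl_c = em_c.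
module Submission where

open import Defs
open import Level using (Level)
open import Data.Product using (_×_; _,_; proj₁; proj₂)
open import Relation.Binary.Bundles using (Setoid)
import Relation.Binary.Reasoning.Setoid as SetoidReasoning

module _ {o ℓ e : Level} (C : Category o ℓ e) where
  open Category C

  homSetoid : Obj → Obj → Setoid ℓ e
  homSetoid X Y = record { Carrier = Hom X Y ; _≈_ = _≈_ ; isEquivalence = ≈-equiv }

  module HomReasoning {X Y : Obj} = SetoidReasoning (homSetoid X Y)
  open HomReasoning
  open module HomSetoid {X Y : Obj} = Setoid (homSetoid X Y) using (refl; sym; trans)

  sym-assoc : ∀ {W X Y Z} {f : Hom W X} {g : Hom X Y} {h : Hom Y Z} →
              h ∘ (g ∘ f) ≈ (h ∘ g) ∘ f
  sym-assoc = sym assoc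

  infixr 4 refl⟩∘⟨_
  infixl 5 _⟩∘⟨refl

  refl⟩∘⟨_ : ∀ {X Y Z} {f : Hom Y Z} {g g' : Hom X Y} → g ≈ g' → f ∘ g ≈ f ∘ g'
  refl⟩∘⟨ p = ∘-resp-≈ refl p

  _⟩∘⟨refl : ∀ {X Y Z} {f f' : Hom Y Z} {g : Hom X Y} → f ≈ f' → f ∘ g ≈ f' ∘ g
  p ⟩∘⟨refl = ∘-resp-≈ p refl

  module _ (F : Endofunctor C) where
    open Endofunctor F

    F-retract : ∀ {X Y} {f : Hom Y X} {g : Hom X Y} → f ∘ g ≈ id → F₁ f ∘ F₁ g ≈ id
    F-retract {f = f} {g} fg≈id = begin
      F₁ f ∘ F₁ g  ≈⟨ homomorphism ⟨
      F₁ (f ∘ g)   ≈⟨ F-resp-≈ fg≈id ⟩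
      F₁ id        ≈⟨ identity ⟩
      id           ∎

    inverse-algebra-hom : ∀ {X Y} {f : Hom X Y} {f⁻¹ : Hom Y X}
                          {x : Hom (F₀ X) X} {y : Hom (F₀ Y) Y} →
                          IsInverse C f f⁻¹ → f ∘ x ≈ y ∘ F₁ f → f⁻¹ ∘ y ≈ x ∘ F₁ f⁻¹
    inverse-algebra-hom {f = f} {f⁻¹} {x} {y} (ff⁻¹≈id , f⁻¹f≈id) f-hom = begin
      f⁻¹ ∘ y                          ≈⟨ refl⟩∘⟨ identityʳ ⟨
      f⁻¹ ∘ (y ∘ id)                   ≈⟨ refl⟩∘⟨ refl⟩∘⟨ F-retract ff⁻¹≈id ⟨
      f⁻¹ ∘ (y ∘ (F₁ f ∘ F₁ f⁻¹))      ≈⟨ refl⟩∘⟨ sym-assoc ⟩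
      f⁻¹ ∘ ((y ∘ F₁ f) ∘ F₁ f⁻¹)      ≈⟨ refl⟩∘⟨ f-hom ⟩∘⟨refl ⟨
      f⁻¹ ∘ ((f ∘ x) ∘ F₁ f⁻¹)         ≈⟨ refl⟩∘⟨ assoc ⟩
      f⁻¹ ∘ (f ∘ (x ∘ F₁ f⁻¹))         ≈⟨ sym-assoc ⟩
      (f⁻¹ ∘ f) ∘ (x ∘ F₁ f⁻¹)         ≈⟨ f⁻¹f≈id ⟩∘⟨refl ⟩
      id ∘ (x ∘ F₁ f⁻¹)                ≈⟨ identityˡ ⟩
      x ∘ F₁ f⁻¹                       ∎

  fixpoint-transfer : (G H : Endofunctor C) →
                      ∀ {X P Q} {c : Hom X (Fo G (Fo H X))}
                      {ℓ₁ : Hom (Fo G (Fo H P)) P} {ℓ₂ : Hom (Fo G (Fo H Q)) Q} {h : Hom P Q} →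
                      h ∘ ℓ₁ ≈ ℓ₂ ∘ Fm G (Fm H h) →
                      {x : Hom X P} → x ≈ ℓ₁ ∘ (Fm G (Fm H x) ∘ c) →
                      h ∘ x ≈ ℓ₂ ∘ (Fm G (Fm H (h ∘ x)) ∘ c)
  fixpoint-transfer G H {c = c} {ℓ₁} {ℓ₂} {h} square {x} x-fix = begin
    h ∘ x                                       ≈⟨ refl⟩∘⟨ x-fix ⟩
    h ∘ (ℓ₁ ∘ (Fm G (Fm H x) ∘ c))              ≈⟨ sym-assoc ⟩
    (h ∘ ℓ₁) ∘ (Fm G (Fm H x) ∘ c)              ≈⟨ square ⟩∘⟨refl ⟩
    (ℓ₂ ∘ Fm G (Fm H h)) ∘ (Fm G (Fm H x) ∘ c)  ≈⟨ assoc ⟩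
    ℓ₂ ∘ (Fm G (Fm H h) ∘ (Fm G (Fm H x) ∘ c))  ≈⟨ refl⟩∘⟨ sym-assoc ⟩
    ℓ₂ ∘ ((Fm G (Fm H h) ∘ Fm G (Fm H x)) ∘ c)  ≈⟨ refl⟩∘⟨ GH-∘ ⟩∘⟨refl ⟨
    ℓ₂ ∘ (Fm G (Fm H (h ∘ x)) ∘ c)              ∎
    where
    GH-∘ : Fm G (Fm H (h ∘ x)) ≈ Fm G (Fm H h) ∘ Fm G (Fm H x)
    GH-∘ = trans (Endofunctor.F-resp-≈ G (Endofunctor.homomorphism H))
                 (Endofunctor.homomorphism G)

  module _ (M : Monad C) where
    open Monad M
    open EMAlgebra
    open Endofunctor T renaming (F₀ to T₀; F₁ to T₁; homomorphism to T-∘; F-resp-≈ to T-resp)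

    extension-preserves-μ : (Y : EMAlgebra C M) → ∀ {X} (f : Hom X (carrier Y)) →
                            (str Y ∘ T₁ f) ∘ μ X ≈ str Y ∘ T₁ (str Y ∘ T₁ f)
    extension-preserves-μ Y {X} f = begin
      (b ∘ T₁ f) ∘ μ X          ≈⟨ assoc ⟩
      b ∘ (T₁ f ∘ μ X)          ≈⟨ refl⟩∘⟨ μ-natural f ⟨
      b ∘ (μ _ ∘ T₁ (T₁ f))     ≈⟨ sym-assoc ⟩
      (b ∘ μ _) ∘ T₁ (T₁ f)     ≈⟨ proj₂ (isEM Y) ⟩∘⟨refl ⟨
      (b ∘ T₁ b) ∘ T₁ (T₁ f)    ≈⟨ assoc ⟩
      b ∘ (T₁ b ∘ T₁ (T₁ f))    ≈⟨ refl⟩∘⟨ T-∘ ⟨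
      b ∘ T₁ (b ∘ T₁ f)         ∎
      where
      b : Hom (T₀ (carrier Y)) (carrier Y)
      b = str Y

    module _ (A B : Endofunctor C)
             (κ : ∀ X → Hom (T₀ (Fo B X)) (Fo B (T₀ X)))
             (ρ : (Y : EMAlgebra C M) → Hom (Fo A (carrier Y)) (Fo B (carrier Y))) where
      open Endofunctor A renaming (F₀ to A₀; F₁ to A₁; homomorphism to A-∘)
      open Endofunctor B renaming (F₀ to B₀; F₁ to B₁; homomorphism to B-∘; F-resp-≈ to B-resp)

      ρ₂-at-algebra : IsEMLaw C M B κ → IsNatAU⇒UB̄ C M A B ρ → (Y : EMAlgebra C M) →
                      B₁ (str Y) ∘ ρ₂ C M A B κ ρ (carrier Y) ≈ B₁ (str Y) ∘ (κ (carrier Y) ∘ T₁ (ρ Y))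
      ρ₂-at-algebra κlaw ρnat Y = begin
        B₁ b ∘ (B₁ (μ Y₀) ∘ (κ (T₀ Y₀) ∘ (T₁ ρF ∘ T₁ (A₁ (η Y₀)))))
          ≈⟨ sym-assoc ⟩
        (B₁ b ∘ B₁ (μ Y₀)) ∘ (κ (T₀ Y₀) ∘ (T₁ ρF ∘ T₁ (A₁ (η Y₀))))
          ≈⟨ Bb∘Bμ ⟩∘⟨refl ⟩
        (B₁ b ∘ B₁ (T₁ b)) ∘ (κ (T₀ Y₀) ∘ (T₁ ρF ∘ T₁ (A₁ (η Y₀))))
          ≈⟨ trans assoc (refl⟩∘⟨ sym-assoc) ⟩
        B₁ b ∘ ((B₁ (T₁ b) ∘ κ (T₀ Y₀)) ∘ (T₁ ρF ∘ T₁ (A₁ (η Y₀))))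
          ≈⟨ refl⟩∘⟨ IsEMLaw.natural κlaw b ⟩∘⟨refl ⟨
        B₁ b ∘ ((κ Y₀ ∘ T₁ (B₁ b)) ∘ (T₁ ρF ∘ T₁ (A₁ (η Y₀))))
          ≈⟨ refl⟩∘⟨ trans assoc (refl⟩∘⟨ sym-assoc) ⟩
        B₁ b ∘ (κ Y₀ ∘ ((T₁ (B₁ b) ∘ T₁ ρF) ∘ T₁ (A₁ (η Y₀))))
          ≈⟨ refl⟩∘⟨ refl⟩∘⟨ trans (sym T-∘) (T-resp (sym ρ-b)) ⟩∘⟨refl ⟩
        B₁ b ∘ (κ Y₀ ∘ (T₁ (ρ Y ∘ A₁ b) ∘ T₁ (A₁ (η Y₀))))
          ≈⟨ refl⟩∘⟨ refl⟩∘⟨ trans (T-∘ ⟩∘⟨refl) assoc ⟩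
        B₁ b ∘ (κ Y₀ ∘ (T₁ (ρ Y) ∘ (T₁ (A₁ b) ∘ T₁ (A₁ (η Y₀)))))
          ≈⟨ refl⟩∘⟨ refl⟩∘⟨ refl⟩∘⟨ F-retract T (F-retract A (proj₁ (isEM Y))) ⟩
        B₁ b ∘ (κ Y₀ ∘ (T₁ (ρ Y) ∘ id))
          ≈⟨ refl⟩∘⟨ refl⟩∘⟨ identityʳ ⟩
        B₁ b ∘ (κ Y₀ ∘ T₁ (ρ Y))
          ∎
        where
        Y₀ : Obj
        Y₀ = carrier Y
        b : Hom (T₀ Y₀) Y₀
        b = str Y
        ρF : Hom (A₀ (T₀ Y₀)) (B₀ (T₀ Y₀))
        ρF = ρ (freeAlg C M Y₀)

        Bb∘Bμ : B₁ b ∘ B₁ (μ Y₀) ≈ B₁ b ∘ B₁ (T₁ b)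
        Bb∘Bμ = trans (sym B-∘) (trans (B-resp (sym (proj₂ (isEM Y)))) B-∘)

        ρ-b : ρ Y ∘ A₁ b ≈ B₁ b ∘ ρF
        ρ-b = ρnat (freeAlg C M Y₀) Y b (sym (proj₂ (isEM Y)))

      module _ (λ' : ∀ X → Hom (A₀ (T₀ X)) (T₀ (A₀ X)))
               (λlaw : IsKleisliLaw C M A λ')
               (ρ-compat : ∀ (Y : EMAlgebra C M) →
                 ρ Y ∘ A₁ (str Y) ≈ B₁ (str Y) ∘ (κ (carrier Y) ∘ (T₁ (ρ Y) ∘ λ' (carrier Y)))) where

        ρ-along-extension : (Y : EMAlgebra C M) → ∀ {X} (h : Hom X (carrier Y)) →
                            B₁ (str Y) ∘ (κ (carrier Y) ∘ (T₁ (ρ Y ∘ A₁ h) ∘ λ' X))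
                              ≈ ρ Y ∘ A₁ (str Y ∘ T₁ h)
        ρ-along-extension Y {X} h = begin
          B₁ b ∘ (κ Y₀ ∘ (T₁ (ρ Y ∘ A₁ h) ∘ λ' X))           ≈⟨ refl⟩∘⟨ refl⟩∘⟨ trans (T-∘ ⟩∘⟨refl) assoc ⟩
          B₁ b ∘ (κ Y₀ ∘ (T₁ (ρ Y) ∘ (T₁ (A₁ h) ∘ λ' X)))    ≈⟨ refl⟩∘⟨ refl⟩∘⟨ refl⟩∘⟨ IsKleisliLaw.natural λlaw h ⟨
          B₁ b ∘ (κ Y₀ ∘ (T₁ (ρ Y) ∘ (λ' Y₀ ∘ A₁ (T₁ h))))   ≈⟨ refl⟩∘⟨ trans (refl⟩∘⟨ sym-assoc) sym-assoc ⟩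
          B₁ b ∘ ((κ Y₀ ∘ (T₁ (ρ Y) ∘ λ' Y₀)) ∘ A₁ (T₁ h))   ≈⟨ sym-assoc ⟩
          (B₁ b ∘ (κ Y₀ ∘ (T₁ (ρ Y) ∘ λ' Y₀))) ∘ A₁ (T₁ h)   ≈⟨ ρ-compat Y ⟩∘⟨refl ⟨
          (ρ Y ∘ A₁ b) ∘ A₁ (T₁ h)                           ≈⟨ trans assoc (refl⟩∘⟨ sym A-∘) ⟩
          ρ Y ∘ A₁ (b ∘ T₁ h)                                ∎
          where
          Y₀ : Obj
          Y₀ = carrier Y
          b : Hom (T₀ Y₀) Y₀
          b = str Y

        module _ (Y : EMAlgebra C M) {ζ : Hom (carrier Y) (B₀ (carrier Y))} {ζ⁻¹ : Hom (B₀ (carrier Y)) (carrier Y)}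
                 (ζ-inverse : IsInverse C ζ ζ⁻¹)
                 (ζ-hom : ζ ∘ str Y ≈ B₁ (str Y) ∘ (κ (carrier Y) ∘ T₁ ζ)) where
          private
            Y₀ : Obj
            Y₀ = carrier Y
            b : Hom (T₀ Y₀) Y₀
            b = str Y

          ζ⁻¹-hom : ζ⁻¹ ∘ (B₁ b ∘ κ Y₀) ≈ b ∘ T₁ ζ⁻¹
          ζ⁻¹-hom = inverse-algebra-hom T ζ-inverse (trans ζ-hom sym-assoc)

          ζ⁻¹ρ-along-extension : ∀ {X} (h : Hom X Y₀) →
                                 (b ∘ T₁ (ζ⁻¹ ∘ (ρ Y ∘ A₁ h))) ∘ λ' X ≈ ζ⁻¹ ∘ (ρ Y ∘ A₁ (b ∘ T₁ h))
          ζ⁻¹ρ-along-extension {X} h = begin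
            (b ∘ T₁ (ζ⁻¹ ∘ (ρ Y ∘ A₁ h))) ∘ λ' X              ≈⟨ (refl⟩∘⟨ T-∘) ⟩∘⟨refl ⟩
            (b ∘ (T₁ ζ⁻¹ ∘ T₁ (ρ Y ∘ A₁ h))) ∘ λ' X           ≈⟨ sym-assoc ⟩∘⟨refl ⟩
            ((b ∘ T₁ ζ⁻¹) ∘ T₁ (ρ Y ∘ A₁ h)) ∘ λ' X           ≈⟨ ζ⁻¹-hom ⟩∘⟨refl ⟩∘⟨refl ⟨
            ((ζ⁻¹ ∘ (B₁ b ∘ κ Y₀)) ∘ T₁ (ρ Y ∘ A₁ h)) ∘ λ' X  ≈⟨ trans assoc (trans assoc (refl⟩∘⟨ assoc)) ⟩
            ζ⁻¹ ∘ (B₁ b ∘ (κ Y₀ ∘ (T₁ (ρ Y ∘ A₁ h) ∘ λ' X)))  ≈⟨ refl⟩∘⟨ ρ-along-extension Y h ⟩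
            ζ⁻¹ ∘ (ρ Y ∘ A₁ (b ∘ T₁ h))                       ∎

          extension-square : IsEMLaw C M B κ → IsNatAU⇒UB̄ C M A B ρ →
                             ∀ {Ψ} (β : Hom (A₀ Ψ) Ψ) (k : Hom Ψ Y₀) → k ∘ β ≈ ζ⁻¹ ∘ (ρ Y ∘ A₁ k) →
                             (b ∘ T₁ k) ∘ (T₁ β ∘ (μ (A₀ Ψ) ∘ T₁ (λ' Ψ)))
                               ≈ (ζ⁻¹ ∘ (B₁ b ∘ ρ₂ C M A B κ ρ Y₀)) ∘ T₁ (A₁ (b ∘ T₁ k))
          extension-square κlaw ρnat {Ψ} β k k-β = begin
            k̄ ∘ (T₁ β ∘ (μ _ ∘ T₁ (λ' Ψ)))                    ≈⟨ sym-assoc ⟩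
            (k̄ ∘ T₁ β) ∘ (μ _ ∘ T₁ (λ' Ψ))                    ≈⟨ trans assoc (refl⟩∘⟨ trans (sym T-∘) (T-resp k-β)) ⟩∘⟨refl ⟩
            (b ∘ T₁ g) ∘ (μ _ ∘ T₁ (λ' Ψ))                    ≈⟨ sym-assoc ⟩
            ((b ∘ T₁ g) ∘ μ _) ∘ T₁ (λ' Ψ)                    ≈⟨ extension-preserves-μ Y g ⟩∘⟨refl ⟩
            (b ∘ T₁ (b ∘ T₁ g)) ∘ T₁ (λ' Ψ)                   ≈⟨ trans assoc (refl⟩∘⟨ sym T-∘) ⟩
            b ∘ T₁ ((b ∘ T₁ g) ∘ λ' Ψ)                        ≈⟨ refl⟩∘⟨ T-resp (ζ⁻¹ρ-along-extension k) ⟩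
            b ∘ T₁ (ζ⁻¹ ∘ (ρ Y ∘ A₁ k̄))                       ≈⟨ trans (refl⟩∘⟨ T-∘) sym-assoc ⟩
            (b ∘ T₁ ζ⁻¹) ∘ T₁ (ρ Y ∘ A₁ k̄)                    ≈⟨ ζ⁻¹-hom ⟩∘⟨refl ⟨
            (ζ⁻¹ ∘ (B₁ b ∘ κ Y₀)) ∘ T₁ (ρ Y ∘ A₁ k̄)           ≈⟨ trans assoc (refl⟩∘⟨ refl⟩∘⟨ T-∘) ⟩
            ζ⁻¹ ∘ ((B₁ b ∘ κ Y₀) ∘ (T₁ (ρ Y) ∘ T₁ (A₁ k̄)))    ≈⟨ refl⟩∘⟨ trans assoc (trans (refl⟩∘⟨ sym-assoc) sym-assoc) ⟩
            ζ⁻¹ ∘ ((B₁ b ∘ (κ Y₀ ∘ T₁ (ρ Y))) ∘ T₁ (A₁ k̄))    ≈⟨ refl⟩∘⟨ ρ₂-at-algebra κlaw ρnat Y ⟩∘⟨refl ⟨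
            ζ⁻¹ ∘ ((B₁ b ∘ ρ₂ C M A B κ ρ Y₀) ∘ T₁ (A₁ k̄))    ≈⟨ sym-assoc ⟩
            (ζ⁻¹ ∘ (B₁ b ∘ ρ₂ C M A B κ ρ Y₀)) ∘ T₁ (A₁ k̄)    ∎
            where
            k̄ : Hom (T₀ Ψ) Y₀
            k̄ = b ∘ T₁ k
            g : Hom (A₀ Ψ) Y₀
            g = ζ⁻¹ ∘ (ρ Y ∘ A₁ k)

theorem7p13 :
  ∀ {o ℓ e : Level} (C : Category o ℓ e) (M : Monad C) →
  let open Category C
      open Monad M
      open EMAlgebra
  in
  (A : Endofunctor C) →
  (Ψ : Obj) (β : Hom (Fo A Ψ) Ψ) (β⁻¹ : Hom Ψ (Fo A Ψ)) →
  IsInverse C β β⁻¹ →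
  IsInitialAlgebra C A Ψ β →
  (λ' : ∀ X → Hom (Fo A (Fo T X)) (Fo T (Fo A X))) →
  IsKleisliLaw C M A λ' →
  IsFinalĀCoalgebra C M A λ' Ψ (J C M β⁻¹) →
  (B : Endofunctor C) →
  (Θ : Obj) (ζ : Hom Θ (Fo B Θ)) (ζ⁻¹ : Hom (Fo B Θ) Θ) →
  IsInverse C ζ ζ⁻¹ →
  IsFinalCoalgebra C B Θ ζ →
  (κ : ∀ X → Hom (Fo T (Fo B X)) (Fo B (Fo T X))) →
  IsEMLaw C M B κ →
  (ρ : (Y : EMAlgebra C M) → Hom (Fo A (carrier Y)) (Fo B (carrier Y))) →
  IsNatAU⇒UB̄ C M A B ρ →
  (∀ (Y : EMAlgebra C M) →
     ρ Y ∘ Fm A (str Y) ≈ Fm B (str Y) ∘ (κ (carrier Y) ∘ (Fm T (ρ Y) ∘ λ' (carrier Y)))) →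
  -- a : T(Θ) → Θ, the unique map with ζ ∘ a = B(a) ∘ κ_Θ ∘ T(ζ),
  -- (Θ, a) is an Eilenberg-Moore algebra (standing fact from the context)
  (a : Hom (Fo T Θ) Θ) →
  ζ ∘ a ≈ Fm B a ∘ (κ Θ ∘ Fm T ζ) →
  (a-EM : IsEMAlgebra C M a) →
  -- k : Ψ → Θ with k ∘ β = ζ⁻¹ ∘ ρ_(Θ,a) ∘ A(k)
  (k : Hom Ψ Θ) →
  k ∘ β ≈ ζ⁻¹ ∘ (ρ (emalg Θ a a-EM) ∘ Fm A k) →
  let k̄ : Hom (Fo T Ψ) Θ
      k̄ = a ∘ Fm T k
      ℓkl : Hom (Fo T (Fo A (Fo T Ψ))) (Fo T Ψ)
      ℓkl = Fm T β ∘ (μ (Fo A Ψ) ∘ Fm T (λ' Ψ))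
      ℓem : Hom (Fo T (Fo A Θ)) Θ
      ℓem = ζ⁻¹ ∘ (Fm B a ∘ ρ₂ C M A B κ ρ Θ)
  in
  (k̄ ∘ ℓkl ≈ ℓem ∘ Fm T (Fm A k̄))
  ×
  (∀ (X : Obj) (c : Hom X (Fo T (Fo A X)))
     (kl : Hom X (Fo T Ψ)) →
     kl ≈ ℓkl ∘ (Fm T (Fm A kl) ∘ c) →
     (em : Hom X Θ) →
     em ≈ ℓem ∘ (Fm T (Fm A em) ∘ c) →
     (∀ (em' : Hom X Θ) → em' ≈ ℓem ∘ (Fm T (Fm A em') ∘ c) → em' ≈ em) →
     k̄ ∘ kl ≈ em)
-- Initiality and the two finality hypotheses only guarantee that a, k, kl and
-- em exist and are unique; the statement already supplies them.
theorem7p13 C M A Ψ β _ _ _ λ' λlaw _ B Θ ζ ζ⁻¹ ζ-inverse _ κ κlaw ρ ρnat ρ-compat a ζ-hom a-EM k k-β =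
  square , λ X c kl kl-fix em _ em-unique →
    em-unique ((a ∘ Fm T k) ∘ kl) (fixpoint-transfer C T A square kl-fix)
  where
  open Category C using (_∘_; _≈_)
  open Monad M using (T; μ)
  square : (a ∘ Fm T k) ∘ (Fm T β ∘ (μ (Fo A Ψ) ∘ Fm T (λ' Ψ)))
             ≈ (ζ⁻¹ ∘ (Fm B a ∘ ρ₂ C M A B κ ρ Θ)) ∘ Fm T (Fm A (a ∘ Fm T k))
  square = extension-square C M A B κ ρ λ' λlaw ρ-compat (emalg Θ a a-EM) ζ-inverse ζ-hom
             κlaw ρnat β k k-β
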